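{- Let $A = \bigoplus_{i\in1..n} A_i$ and $B = \bigoplus_{j\in1..m} B_j$ be $\mu$-types, and let $f : 1..n\to1..m$ and $g:1..m\to1..n$ be functions such that $A_i \simeq_\mu B_{f(i)}$ and $A_{g(j)}\simeq_\mu B_j$ for every $i\in1..n$, $j\in1..m$. Then $\bigoplus_{i\in1..n}A_i \simeq_\mu \bigoplus_{j\in1..m}B_j$. (The $A_i,B_j$ need not be non-union types.)
   Context: Fix disjoint countably infinite sets of datatype variables $\alpha,\dots$, type variables $X,\dots$, type constants $\mathsf c,\dots$; $V$ ranges over variables. $\mu$-datatypes $D ::= \alpha \mid \mathsf{c} \mid D @ A \mid D \oplus D \mid \mu\alpha.D$; $\mu$-types $A ::= X \mid D \mid A \supset A \mid A \oplus A \mid \mu X.A$, all required contractive ($V$ occurs in $A$ in $\mu V.A$ only under $\supset$ or $@$). $\bigoplus_{i\in1..n}A_i$ denotes $n-1$ applications of the binary $\oplus$ to $A_1,\dots,A_n$ in this order, in any association. $\simeq_\mu$ is the least relation closed under reflexivity, symmetry, transitivity, congruence for $\supset,@,\oplus,\mu V$, and the axioms $A\oplus A\simeq A$, $A\oplus B\simeq B\oplus A$, $A\oplus(B\oplus C)\simeq(A\oplus B)\oplus C$, $\mu V.A\simeq A\{V:=\mu V.A\}$, and: $A\simeq B\{V:=A\}$ with $\mu V.B$ contractive implies $A\simeq\mu V.B$. -}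

module Defs where

open import Data.Nat using (ℕ; zero; suc)
open import Data.Bool using (Bool; true; false; if_then_else_)
open import Data.Unit using (⊤)
open import Data.Product using (_×_)
open import Data.Fin using (Fin)
open import Data.List using (List; []; _∷_; _++_)
open import Relation.Binary.PropositionalEquality using (_≢_)

-- Two sorts of variables: datatype variables (α) and type variables (X).
data Sort : Set where
  dS tS : Sort

sameSort : Sort → Sort → Bool
sameSort dS dS = true
sameSort tS tS = true
sameSort _  _  = false

-- Raw syntax, nameless (de Bruijn) per sort: `var s n` is the variable of
-- sort s bound by the n-th enclosing `mu s` binder (free if none).
-- Alpha-equivalent terms are therefore syntactically equal.
data Ty : Set where
  var  : Sort → ℕ → Ty
  con  : ℕ → Ty
  app  : Ty → Ty → Ty
  arr  : Ty → Ty → Ty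
  plus : Ty → Ty → Ty
  mu   : Sort → Ty → Ty

mutual
  data IsD : Ty → Set where
    dvar : ∀ n → IsD (var dS n)
    dcon : ∀ c → IsD (con c)
    dapp : ∀ {d a} → IsD d → IsA a → IsD (app d a)
    dplus : ∀ {d e} → IsD d → IsD e → IsD (plus d e)
    dmu : ∀ {d} → IsD d → IsD (mu dS d)

  data IsA : Ty → Set where
    avar : ∀ n → IsA (var tS n)
    adat : ∀ {d} → IsD d → IsA d
    aarr : ∀ {a b} → IsA a → IsA b → IsA (arr a b)
    aplus : ∀ {a b} → IsA a → IsA b → IsA (plus a b)
    amu : ∀ {a} → IsA a → IsA (mu tS a)

-- Guarded s n t : the variable (s , n) occurs in t only under ⊃ or @.
Guarded : Sort → ℕ → Ty → Set
Guarded s n (var s' m) = if sameSort s s' then m ≢ n else ⊤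
Guarded s n (con c) = ⊤
Guarded s n (app t u) = ⊤
Guarded s n (arr t u) = ⊤
Guarded s n (plus t u) = Guarded s n t × Guarded s n u
Guarded s n (mu s' t) = Guarded s (if sameSort s s' then suc n else n) t

Contractive : Ty → Set
Contractive (var s n) = ⊤
Contractive (con c) = ⊤
Contractive (app t u) = Contractive t × Contractive u
Contractive (arr t u) = Contractive t × Contractive u
Contractive (plus t u) = Contractive t × Contractive u
Contractive (mu s t) = Guarded s zero t × Contractive t

WF : Ty → Set
WF t = IsA t × Contractive t

extR : (ℕ → ℕ) → ℕ → ℕ
extR ρ zero = zero
extR ρ (suc n) = suc (ρ n)

ren : Sort → (ℕ → ℕ) → Ty → Ty
ren s ρ (var s' n) = if sameSort s s' then var s' (ρ n) else var s' n
ren s ρ (con c) = con c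
ren s ρ (app t u) = app (ren s ρ t) (ren s ρ u)
ren s ρ (arr t u) = arr (ren s ρ t) (ren s ρ u)
ren s ρ (plus t u) = plus (ren s ρ t) (ren s ρ u)
ren s ρ (mu s' t) = mu s' (ren s (if sameSort s s' then extR ρ else ρ) t)

liftS : Sort → Sort → (ℕ → Ty) → ℕ → Ty
liftS s s' σ n with sameSort s s'
... | false = ren s' suc (σ n)
liftS s s' σ zero | true = var s zero
liftS s s' σ (suc n) | true = ren s suc (σ n)

sub : Sort → (ℕ → Ty) → Ty → Ty
sub s σ (var s' n) = if sameSort s s' then σ n else var s' n
sub s σ (con c) = con c
sub s σ (app t u) = app (sub s σ t) (sub s σ u)
sub s σ (arr t u) = arr (sub s σ t) (sub s σ u)
sub s σ (plus t u) = plus (sub s σ t) (sub s σ u)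
sub s σ (mu s' t) = mu s' (sub s (liftS s s' σ) t)

-- B {V := A}, where V is the variable bound by an enclosing μ of sort s
-- (index 0 of sort s in the body B).
sub1 : Sort → Ty → Ty → Ty
sub1 s a b = sub s σ b
  where
  σ : ℕ → Ty
  σ zero = a
  σ (suc n) = var s n

infix 4 _≃μ_
data _≃μ_ : Ty → Ty → Set where
  refl≃  : ∀ {a} → WF a → a ≃μ a
  sym≃   : ∀ {a b} → a ≃μ b → b ≃μ a
  trans≃ : ∀ {a b c} → a ≃μ b → b ≃μ c → a ≃μ c
  arr≃   : ∀ {a a' b b'} → a ≃μ a' → b ≃μ b' → WF (arr a b) → WF (arr a' b') →
           arr a b ≃μ arr a' b'
  app≃   : ∀ {a a' b b'} → a ≃μ a' → b ≃μ b' → WF (app a b) → WF (app a' b') →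
           app a b ≃μ app a' b'
  plus≃  : ∀ {a a' b b'} → a ≃μ a' → b ≃μ b' → WF (plus a b) → WF (plus a' b') →
           plus a b ≃μ plus a' b'
  mu≃    : ∀ {s a b} → a ≃μ b → WF (mu s a) → WF (mu s b) → mu s a ≃μ mu s b
  idem   : ∀ {a} → WF a → plus a a ≃μ a
  comm   : ∀ {a b} → WF (plus a b) → plus a b ≃μ plus b a
  assoc  : ∀ {a b c} → WF (plus a (plus b c)) →
           plus a (plus b c) ≃μ plus (plus a b) c
  fold   : ∀ {s a} → WF (mu s a) → mu s a ≃μ sub1 s (mu s a) a
  contr  : ∀ {s a b} → a ≃μ sub1 s a b → WF (mu s b) → a ≃μ mu s b

-- BigPlus xs t : t is ⊕ applied (length xs - 1 times) to the elements of
-- the nonempty list xs, in this order, in some association.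
data BigPlus : List Ty → Ty → Set where
  one  : ∀ a → BigPlus (a ∷ []) a
  node : ∀ {xs ys a b} → BigPlus xs a → BigPlus ys b → BigPlus (xs ++ ys) (plus a b)

module Submission where

-- Say that a type t ABSORBS x when t ⊕ x ≃μ t.  By
-- idempotence, commutativity and associativity of ⊕, a big sum absorbs
-- each of its summands, and it absorbs a second big sum as soon as it
-- absorbs every summand of that sum.  Absorption is invariant under ≃μ in
-- the absorbed argument, so if every summand B_j of B is ≃μ to some
-- summand A_{g(j)} of A, then A absorbs B.  The hypotheses on f and g give
-- such coverings in both directions, hence A absorbs B and B absorbs A,
-- and then  A ≃μ A ⊕ B ≃μ B ⊕ A ≃μ B.

open import Defs
open import Data.Nat using (ℕ)
open import Data.Fin using (Fin)
open import Data.List using (tabulate)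
open import Data.Product using (_×_; _,_; ∃)
open import Data.Sum using (inj₁; inj₂)
open import Data.List.Relation.Unary.Any using (here; there)
open import Data.List.Membership.Propositional using (_∈_)
open import Data.List.Membership.Propositional.Properties
  using (∈-++⁺ˡ; ∈-++⁺ʳ; ∈-++⁻; ∈-tabulate⁺; ∈-tabulate⁻)
open import Relation.Binary.PropositionalEquality using (refl)
open import Relation.Binary.Bundles using (PartialSetoid)

-- ≃μ is symmetric and transitive, but reflexive only on well-formed
-- types, so chains of ≃μ-steps use partial-setoid reasoning.
≃μ-partialSetoid : PartialSetoid _ _
≃μ-partialSetoid = record
  { _≈_ = _≃μ_
  ; isPartialEquivalence = record { sym = sym≃ ; trans = trans≃ }
  }

open import Relation.Binary.Reasoning.PartialSetoid ≃μ-partialSetoid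

wf-plusˡ : ∀ {a b} → WF (plus a b) → WF a
wf-plusˡ (aplus wa _ , ca , _) = wa , ca
wf-plusˡ (adat (dplus da _) , ca , _) = adat da , ca

wf-plusʳ : ∀ {a b} → WF (plus a b) → WF b
wf-plusʳ (aplus _ wb , _ , cb) = wb , cb
wf-plusʳ (adat (dplus _ db) , _ , cb) = adat db , cb

wf-plus : ∀ {a b} → WF a → WF b → WF (plus a b)
wf-plus (wa , ca) (wb , cb) = aplus wa wb , ca , cb

summand-wf : ∀ {xs t x} → BigPlus xs t → WF t → x ∈ xs → WF x
summand-wf (one a) wt (here refl) = wt
summand-wf (node {xs} p q) wt x∈ with ∈-++⁻ xs x∈
... | inj₁ x∈xs = summand-wf p (wf-plusˡ wt) x∈xs
... | inj₂ x∈ys = summand-wf q (wf-plusʳ wt) x∈ys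

_absorbs_ : Ty → Ty → Set
t absorbs x = plus t x ≃μ t

-- A big sum absorbs each of its summands: move the summand next to its
-- copy inside the sum by commutativity/associativity and apply idempotence.
sum-absorbs-summand : ∀ {xs t x} → BigPlus xs t → WF t → x ∈ xs → t absorbs x
sum-absorbs-summand (one a) wt (here refl) = idem wt
sum-absorbs-summand {x = x} (node {xs} {a = a} {b = b} p q) wab x∈ with ∈-++⁻ xs x∈
... | inj₁ x∈xs = begin
    plus (plus a b) x  ≈⟨ plus≃ (comm wab) (refl≃ wx) (wf-plus wab wx) (wf-plus wba wx) ⟩
    plus (plus b a) x  ≈⟨ sym≃ (assoc (wf-plus wb (wf-plus wa wx))) ⟩
    plus b (plus a x)  ≈⟨ plus≃ (refl≃ wb) (sum-absorbs-summand p wa x∈xs)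
                                (wf-plus wb (wf-plus wa wx)) wba ⟩
    plus b a           ≈⟨ comm wba ⟩
    plus a b           ∎
  where
  wa : WF a
  wa = wf-plusˡ wab
  wb : WF b
  wb = wf-plusʳ wab
  wba : WF (plus b a)
  wba = wf-plus wb wa
  wx : WF x
  wx = summand-wf p wa x∈xs
... | inj₂ x∈ys = begin
    plus (plus a b) x  ≈⟨ sym≃ (assoc (wf-plus wa (wf-plus wb wx))) ⟩
    plus a (plus b x)  ≈⟨ plus≃ (refl≃ wa) (sum-absorbs-summand q wb x∈ys)
                                (wf-plus wa (wf-plus wb wx)) wab ⟩
    plus a b           ∎
  where
  wa : WF a
  wa = wf-plusˡ wab
  wb : WF b
  wb = wf-plusʳ wab
  wx : WF x
  wx = summand-wf q wb x∈ys

absorbs-resp-≃μ : ∀ {t x y} → WF t → WF x → WF y →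
                  x ≃μ y → t absorbs x → t absorbs y
absorbs-resp-≃μ {t} {x} {y} wt wx wy x≃y t⊕x≃t = begin
  plus t y  ≈⟨ plus≃ (refl≃ wt) (sym≃ x≃y) (wf-plus wt wy) (wf-plus wt wx) ⟩
  plus t x  ≈⟨ t⊕x≃t ⟩
  t         ∎

-- A type absorbing every summand of a big sum absorbs the whole sum: peel
-- off the two halves of the sum one after the other by associativity.
absorbs-sum : ∀ {ys u t} → BigPlus ys u → WF u → WF t →
              (∀ {y} → y ∈ ys → t absorbs y) → t absorbs u
absorbs-sum (one a) wu wt absorbs-all = absorbs-all (here refl)
absorbs-sum {t = t} (node {xs} {a = a} {b = b} p q) wab wt absorbs-all = begin
  plus t (plus a b)  ≈⟨ assoc (wf-plus wt wab) ⟩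
  plus (plus t a) b  ≈⟨ plus≃ t⊕a≃t (refl≃ wb) (wf-plus (wf-plus wt wa) wb) (wf-plus wt wb) ⟩
  plus t b           ≈⟨ absorbs-sum q wb wt (λ y∈ → absorbs-all (∈-++⁺ʳ xs y∈)) ⟩
  t                  ∎
  where
  wa : WF a
  wa = wf-plusˡ wab
  wb : WF b
  wb = wf-plusʳ wab
  t⊕a≃t : t absorbs a
  t⊕a≃t = absorbs-sum p wa wt (λ y∈ → absorbs-all (∈-++⁺ˡ y∈))

covered⇒absorbs : ∀ {xs ys t u} → BigPlus xs t → BigPlus ys u → WF t → WF u →
                  (∀ {y} → y ∈ ys → ∃ λ x → x ∈ xs × x ≃μ y) → t absorbs u
covered⇒absorbs {ys = ys} {t} pt pu wt wu covered = absorbs-sum pu wu wt absorbs-summand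
  where
  absorbs-summand : ∀ {y} → y ∈ ys → t absorbs y
  absorbs-summand y∈ with covered y∈
  ... | x , x∈ , x≃y = absorbs-resp-≃μ wt (summand-wf pt wt x∈) (summand-wf pu wu y∈)
                                       x≃y (sum-absorbs-summand pt wt x∈)

mutual-absorption⇒≃μ : ∀ {t u} → WF t → WF u → t absorbs u → u absorbs t → t ≃μ u
mutual-absorption⇒≃μ {t} {u} wt wu t⊕u≃t u⊕t≃u = begin
  t         ≈˘⟨ t⊕u≃t ⟩
  plus t u  ≈⟨ comm (wf-plus wt wu) ⟩
  plus u t  ≈⟨ u⊕t≃u ⟩
  u         ∎

lemma3p6 : (n m : ℕ) (As : Fin n → Ty) (Bs : Fin m → Ty) (A B : Ty) →
           BigPlus (tabulate As) A → BigPlus (tabulate Bs) B →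
           WF A → WF B →
           (f : Fin n → Fin m) (g : Fin m → Fin n) →
           (∀ i → As i ≃μ Bs (f i)) → (∀ j → As (g j) ≃μ Bs j) →
           A ≃μ B
lemma3p6 n m As Bs A B pA pB wA wB f g Ai≃Bfi Agj≃Bj =
  mutual-absorption⇒≃μ wA wB
    (covered⇒absorbs pA pB wA wB B-covered-by-A)
    (covered⇒absorbs pB pA wB wA A-covered-by-B)
  where
  B-covered-by-A : ∀ {y} → y ∈ tabulate Bs → ∃ λ x → x ∈ tabulate As × x ≃μ y
  B-covered-by-A y∈ with ∈-tabulate⁻ y∈
  ... | j , refl = As (g j) , ∈-tabulate⁺ (g j) , Agj≃Bj j

  A-covered-by-B : ∀ {y} → y ∈ tabulate As → ∃ λ x → x ∈ tabulate Bs × x ≃μ y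
  A-covered-by-B y∈ with ∈-tabulate⁻ y∈
  ... | i , refl = Bs (f i) , ∈-tabulate⁺ (f i) , sym≃ (Ai≃Bfi i)
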